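{- For any orientable map with a single vertex or a single face, the transition matrix satisfies $U^2=I$.
   Context: An orientable map $X$ is a 2-cell embedding of a finite connected multigraph (loops and parallel edges allowed) in a closed orientable surface, with vertex set $V$ and face set $F$. Each edge gives two arcs on opposite sides of it, pointing in opposite directions, each lying in a face and oriented along its clockwise facial walk. Let $\mathcal A$ be the arc set, $v(a)$ the tail vertex and $f(a)$ the face of arc $a$; $N\in\{0,1\}^{\mathcal A\times V}$ with $N(a,w)=1$ iff $w=v(a)$; $M\in\{0,1\}^{\mathcal A\times F}$ with $M(a,f)=1$ iff $f=f(a)$; $D=N^TN$, $\Delta=M^TM$; $\hat N=ND^{ -1/2}$, $\hat M=M\Delta^{ -1/2}$, $Q=\hat N\hat N^T$, $P=\hat M\hat M^T$; the transition matrix is $U=(2P-I)(2Q-I)$. -}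

module Defs where

open import Data.Nat using (ℕ; zero; suc)
open import Data.Fin using (Fin; zero; suc)
open import Data.Fin.Properties using () renaming (_≟_ to _≟ᶠ_)
open import Data.Fin.Permutation using (Permutation′; _⟨$⟩ʳ_)
open import Data.Rational using (ℚ; 0ℚ; 1ℚ; _+_; _*_; _-_; 1/_; ≢-nonZero)
open import Data.Rational.Properties using (_≟_)
open import Data.Product using (∃-syntax; _×_)
open import Function using (_∘_)
open import Relation.Nullary using (¬_; yes; no)
open import Relation.Binary.PropositionalEquality using (_≡_; _≢_)

Matrix : ℕ → ℕ → Set
Matrix m n = Fin m → Fin n → ℚ

∑ : ∀ {n} → (Fin n → ℚ) → ℚ
∑ {zero}  f = 0ℚ
∑ {suc n} f = f zero + ∑ (f ∘ suc)

infix 30 _ᵀ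
infixl 20 _·_

_ᵀ : ∀ {m n} → Matrix m n → Matrix n m
(A ᵀ) i j = A j i

_·_ : ∀ {m k n} → Matrix m k → Matrix k n → Matrix m n
(A · B) i j = ∑ (λ l → A i l * B l j)

I : ∀ {n} → Matrix n n
I i j with i ≟ᶠ j
... | yes _ = 1ℚ
... | no  _ = 0ℚ

refl2 : ∀ {n} → Matrix n n → Matrix n n
refl2 A i j = (A i j + A i j) - I i j

-- inverse of a rational, (total: 0 ↦ 0; only applied to nonzero values)
inv : ℚ → ℚ
inv p with p ≟ 0ℚ
... | yes _  = 0ℚ
... | no p≢0 = 1/_ p {{≢-nonZero p≢0}}

diagInv : ∀ {n} → Matrix n n → Matrix n n
diagInv D i j with i ≟ᶠ j
... | yes _ = inv (D i i)
... | no  _ = 0ℚ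

incidence : ∀ {m n} → (Fin m → Fin n) → Matrix m n
incidence g a x with g a ≟ᶠ x
... | yes _ = 1ℚ
... | no  _ = 0ℚ

-- For an incidence matrix N with D = NᵀN diagonal,
-- N̂ N̂ᵀ = N D^{-1/2} D^{-1/2} Nᵀ = N D^{-1} Nᵀ.
projection : ∀ {m n} → Matrix m n → Matrix m m
projection N = N · (diagInv (N ᵀ · N) · (N ᵀ))

-- Combinatorial (orientable) maps: arcs = darts Fin nA, rotation σ,
-- edge involution α; faces are orbits of the face permutation σ∘α.

iter : ∀ {n} → (Fin n → Fin n) → ℕ → Fin n → Fin n
iter f zero    a = a
iter f (suc k) a = f (iter f k a)

SameOrbit : ∀ {n} → (Fin n → Fin n) → Fin n → Fin n → Set
SameOrbit f a b = ∃[ k ] (iter f k a ≡ b)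

data Reach {n} (σ α : Fin n → Fin n) : Fin n → Fin n → Set where
  here  : ∀ {a} → Reach σ α a a
  stepσ : ∀ {a b} → Reach σ α (σ a) b → Reach σ α a b
  stepα : ∀ {a b} → Reach σ α (α a) b → Reach σ α a b

Surjective : ∀ {m n} → (Fin m → Fin n) → Set
Surjective g = ∀ y → ∃[ x ] (g x ≡ y)

record OrientableMap : Set where
  field
    nA nV nF : ℕ
    σ α      : Permutation′ nA
    tail     : Fin nA → Fin nV
    face     : Fin nA → Fin nF
    α-invol  : ∀ a → α ⟨$⟩ʳ (α ⟨$⟩ʳ a) ≡ a
    α-fpf    : ∀ a → α ⟨$⟩ʳ a ≢ a
    connected : ∀ a b → Reach (σ ⟨$⟩ʳ_) (α ⟨$⟩ʳ_) a b
    tail-surj : Surjective tail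
    face-surj : Surjective face
    -- vertices are the σ-orbits of arcs (arcs leaving the vertex, in rotation order)
    tail-orbit₁ : ∀ a b → tail a ≡ tail b → SameOrbit (σ ⟨$⟩ʳ_) a b
    tail-orbit₂ : ∀ a b → SameOrbit (σ ⟨$⟩ʳ_) a b → tail a ≡ tail b
    face-orbit₁ : ∀ a b → face a ≡ face b
                  → SameOrbit (λ x → σ ⟨$⟩ʳ (α ⟨$⟩ʳ x)) a b
    face-orbit₂ : ∀ a b → SameOrbit (λ x → σ ⟨$⟩ʳ (α ⟨$⟩ʳ x)) a b
                  → face a ≡ face b

module _ (X : OrientableMap) where
  open OrientableMap X

  Nmat : Matrix nA nV
  Nmat = incidence tail

  Mmat : Matrix nA nF
  Mmat = incidence face

  Qmat : Matrix nA nA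
  Qmat = projection Nmat

  Pmat : Matrix nA nA
  Pmat = projection Mmat

  transition : Matrix nA nA
  transition = refl2 Pmat · refl2 Qmat

-- If the vertex map (or the face map) is constant, Q (resp. P) is the constant matrix J/|A|.
-- Both P and Q are symmetric idempotents with unit row sums, so the constant one, K, absorbs
-- the other, R: RK = KR = K. Then E = K - R satisfies E² = -E, both reflection products equal
-- I + 2E, and (I + 2E)² = I + 4E + 4E² = I.
module Submission where

open import Defs
open import Data.Nat using (ℕ; zero; suc)
open import Data.Fin using (Fin; zero; suc)
open import Data.Fin.Properties using (suc-injective) renaming (_≟_ to _≟ᶠ_)
open import Data.Rational using (ℚ; 0ℚ; 1ℚ; _+_; _*_; -_; ≢-nonZero; _≤_; _<_)
open import Data.Rational.Properties
  using ( _≟_; +-identityˡ; +-identityʳ; *-identityˡ; *-identityʳ; *-zeroˡ; *-zeroʳ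
        ; *-distribˡ-+; *-distribʳ-+; *-inverseˡ
        ; ≤-refl; <⇒≢; +-mono-≤; +-mono-<-≤; +-mono-≤-<; nonNegative⁻¹; positive⁻¹ )
open import Data.Rational.Solver using (module +-*-Solver)
open import Data.Sum using (_⊎_; inj₁; inj₂)
open import Data.Empty using (⊥-elim)
open import Function using (_∘_)
open import Relation.Nullary using (yes; no; Irrelevant)
open import Relation.Binary.PropositionalEquality
  using (_≡_; _≢_; ≢-sym; refl; sym; trans; cong; cong₂; subst; module ≡-Reasoning)

open +-*-Solver using (solve; _:+_; _:*_; _:-_; _:=_; con)

private
  variable
    m n k : ℕ

two : ℚ
two = 1ℚ + 1ℚ

inv-inverseˡ : ∀ x → x ≢ 0ℚ → inv x * x ≡ 1ℚ
inv-inverseˡ x x≢0 with x ≟ 0ℚ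
... | yes x≡0 = ⊥-elim (x≢0 x≡0)
... | no  x≢0 = *-inverseˡ x {{≢-nonZero x≢0}}

Fin1-irrelevant : n ≡ 1 → Irrelevant (Fin n)
Fin1-irrelevant refl zero zero = refl

∑-cong : {f g : Fin n → ℚ} → (∀ i → f i ≡ g i) → ∑ f ≡ ∑ g
∑-cong {zero}  f≗g = refl
∑-cong {suc n} f≗g = cong₂ _+_ (f≗g zero) (∑-cong (f≗g ∘ suc))

∑-zero : (f : Fin n → ℚ) → (∀ i → f i ≡ 0ℚ) → ∑ f ≡ 0ℚ
∑-zero {zero}  f f≗0 = refl
∑-zero {suc n} f f≗0 = trans (cong₂ _+_ (f≗0 zero) (∑-zero (f ∘ suc) (f≗0 ∘ suc))) (+-identityˡ 0ℚ)

∑-single : (f : Fin n → ℚ) (i : Fin n) → (∀ j → j ≢ i → f j ≡ 0ℚ) → ∑ f ≡ f i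
∑-single {suc n} f zero f≗0 =
  trans (cong (f zero +_) (∑-zero (f ∘ suc) (λ j → f≗0 (suc j) λ ()))) (+-identityʳ (f zero))
∑-single {suc n} f (suc i) f≗0 =
  trans (cong (_+ ∑ (f ∘ suc)) (f≗0 zero λ ()))
        (trans (+-identityˡ _) (∑-single (f ∘ suc) i (λ j j≢i → f≗0 (suc j) (j≢i ∘ suc-injective))))

∑-*-singleˡ : (f h : Fin n → ℚ) (i : Fin n) → (∀ j → j ≢ i → f j ≡ 0ℚ) → ∑ (λ j → f j * h j) ≡ f i * h i
∑-*-singleˡ f h i f≗0 = ∑-single _ i (λ j j≢i → trans (cong (_* h j) (f≗0 j j≢i)) (*-zeroˡ (h j)))

∑-*-singleʳ : (f h : Fin n → ℚ) (i : Fin n) → (∀ j → j ≢ i → h j ≡ 0ℚ) → ∑ (λ j → f j * h j) ≡ f i * h i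
∑-*-singleʳ f h i h≗0 = ∑-single _ i (λ j j≢i → trans (cong (f j *_) (h≗0 j j≢i)) (*-zeroʳ (f j)))

∑-*ˡ : ∀ c (f : Fin n → ℚ) → ∑ (λ i → c * f i) ≡ c * ∑ f
∑-*ˡ {zero}  c f = sym (*-zeroʳ c)
∑-*ˡ {suc n} c f =
  trans (cong (c * f zero +_) (∑-*ˡ c (f ∘ suc))) (sym (*-distribˡ-+ c (f zero) (∑ (f ∘ suc))))

∑-*ʳ : ∀ c (f : Fin n → ℚ) → ∑ (λ i → f i * c) ≡ ∑ f * c
∑-*ʳ {zero}  c f = sym (*-zeroˡ c)
∑-*ʳ {suc n} c f =
  trans (cong (f zero * c +_) (∑-*ʳ c (f ∘ suc))) (sym (*-distribʳ-+ c (f zero) (∑ (f ∘ suc))))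

∑-bilinear : ∀ a b c d (x y z w : Fin n → ℚ) →
  ∑ (λ l → (a * x l + b * y l) * (c * z l + d * w l)) ≡
  a * c * ∑ (λ l → x l * z l) + a * d * ∑ (λ l → x l * w l)
    + b * c * ∑ (λ l → y l * z l) + b * d * ∑ (λ l → y l * w l)
∑-bilinear {zero} a b c d x y z w =
  solve 4 (λ a b c d → con 0ℚ
                      := a :* c :* con 0ℚ :+ a :* d :* con 0ℚ :+ b :* c :* con 0ℚ :+ b :* d :* con 0ℚ)
    refl a b c d
∑-bilinear {suc n} a b c d x y z w =
  trans (cong ((a * x zero + b * y zero) * (c * z zero + d * w zero) +_)
              (∑-bilinear a b c d (x ∘ suc) (y ∘ suc) (z ∘ suc) (w ∘ suc)))
    (solve 12 (λ a b c d x y z w s₁ s₂ s₃ s₄ →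
         (a :* x :+ b :* y) :* (c :* z :+ d :* w)
           :+ (a :* c :* s₁ :+ a :* d :* s₂ :+ b :* c :* s₃ :+ b :* d :* s₄)
       := a :* c :* (x :* z :+ s₁) :+ a :* d :* (x :* w :+ s₂)
            :+ b :* c :* (y :* z :+ s₃) :+ b :* d :* (y :* w :+ s₄))
       refl a b c d (x zero) (y zero) (z zero) (w zero)
       (∑ (λ l → x (suc l) * z (suc l))) (∑ (λ l → x (suc l) * w (suc l)))
       (∑ (λ l → y (suc l) * z (suc l))) (∑ (λ l → y (suc l) * w (suc l))))

∑-nonneg : (f : Fin n → ℚ) → (∀ i → 0ℚ ≤ f i) → 0ℚ ≤ ∑ f
∑-nonneg {zero}  f f≥0 = ≤-refl
∑-nonneg {suc n} f f≥0 = +-mono-≤ (f≥0 zero) (∑-nonneg (f ∘ suc) (f≥0 ∘ suc))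

∑-pos : (f : Fin n → ℚ) (i : Fin n) → (∀ j → 0ℚ ≤ f j) → 0ℚ < f i → 0ℚ < ∑ f
∑-pos {suc n} f zero    f≥0 fi>0 = +-mono-<-≤ fi>0 (∑-nonneg (f ∘ suc) (f≥0 ∘ suc))
∑-pos {suc n} f (suc i) f≥0 fi>0 = +-mono-≤-< (f≥0 zero) (∑-pos (f ∘ suc) i (f≥0 ∘ suc) fi>0)

infix  4 _≋_
infixl 10 _⊕_ _⊖_
infixl 15 _⊙_

_≋_ : Matrix m n → Matrix m n → Set
A ≋ B = ∀ i j → A i j ≡ B i j

_⊙_ : ℚ → Matrix m n → Matrix m n
(c ⊙ A) i j = c * A i j

_⊕_ : Matrix m n → Matrix m n → Matrix m n
(A ⊕ B) i j = A i j + B i j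

-- Written as a linear combination so that ·-bilinear applies to differences as they stand.
_⊖_ : Matrix m n → Matrix m n → Matrix m n
A ⊖ B = 1ℚ ⊙ A ⊕ (- 1ℚ) ⊙ B

Idempotent : Matrix n n → Set
Idempotent A = A · A ≋ A

RowStochastic : Matrix m n → Set
RowStochastic A = ∀ i → ∑ (A i) ≡ 1ℚ

Symmetric : Matrix n n → Set
Symmetric A = ∀ i j → A i j ≡ A j i

Constant : Matrix m n → Set
Constant C = ∀ i j i′ j′ → C i j ≡ C i′ j′

I-diag : (i : Fin n) → I i i ≡ 1ℚ
I-diag i with i ≟ᶠ i
... | yes _   = refl
... | no  i≢i = ⊥-elim (i≢i refl)

I-offdiag : {i j : Fin n} → i ≢ j → I i j ≡ 0ℚ
I-offdiag {i = i} {j} i≢j with i ≟ᶠ j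
... | yes i≡j = ⊥-elim (i≢j i≡j)
... | no  _   = refl

diagInv-diag : (D : Matrix n n) (i : Fin n) → diagInv D i i ≡ inv (D i i)
diagInv-diag D i with i ≟ᶠ i
... | yes _   = refl
... | no  i≢i = ⊥-elim (i≢i refl)

diagInv-offdiag : (D : Matrix n n) {i j : Fin n} → i ≢ j → diagInv D i j ≡ 0ℚ
diagInv-offdiag D {i} {j} i≢j with i ≟ᶠ j
... | yes i≡j = ⊥-elim (i≢j i≡j)
... | no  _   = refl

·-cong : {A A′ : Matrix m k} {B B′ : Matrix k n} → A ≋ A′ → B ≋ B′ → A · B ≋ A′ · B′
·-cong A≋A′ B≋B′ i j = ∑-cong (λ l → cong₂ _*_ (A≋A′ i l) (B≋B′ l j))

·-identityˡ : (A : Matrix m n) → I · A ≋ A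
·-identityˡ A i j = begin
  ∑ (λ l → I i l * A l j) ≡⟨ ∑-*-singleˡ (I i) (λ l → A l j) i (λ l l≢i → I-offdiag (l≢i ∘ sym)) ⟩
  I i i * A i j           ≡⟨ cong (_* A i j) (I-diag i) ⟩
  1ℚ * A i j              ≡⟨ *-identityˡ (A i j) ⟩
  A i j                   ∎
  where open ≡-Reasoning

·-identityʳ : (A : Matrix m n) → A · I ≋ A
·-identityʳ A i j = begin
  ∑ (λ l → A i l * I l j) ≡⟨ ∑-*-singleʳ (A i) (λ l → I l j) j (λ l → I-offdiag) ⟩
  A i j * I j j           ≡⟨ cong (A i j *_) (I-diag j) ⟩
  A i j * 1ℚ              ≡⟨ *-identityʳ (A i j) ⟩
  A i j                   ∎
  where open ≡-Reasoning

·-bilinear : ∀ a (A : Matrix m k) b B c (C : Matrix k n) d D {AC AD BC BD : Matrix m n} →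
  A · C ≋ AC → A · D ≋ AD → B · C ≋ BC → B · D ≋ BD →
  (a ⊙ A ⊕ b ⊙ B) · (c ⊙ C ⊕ d ⊙ D) ≋ (a * c) ⊙ AC ⊕ (a * d) ⊙ AD ⊕ (b * c) ⊙ BC ⊕ (b * d) ⊙ BD
·-bilinear a A b B c C d D AC≋ AD≋ BC≋ BD≋ i j =
  trans (∑-bilinear a b c d (A i) (B i) (λ l → C l j) (λ l → D l j))
    (cong₂ _+_ (cong₂ _+_ (cong₂ _+_ (cong (a * c *_) (AC≋ i j)) (cong (a * d *_) (AD≋ i j)))
                          (cong (b * c *_) (BC≋ i j)))
               (cong (b * d *_) (BD≋ i j)))

·-constantʳ : {A : Matrix m m} {C : Matrix m n} → RowStochastic A → Constant C → A · C ≋ C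
·-constantʳ {A = A} {C} A-row C-const i j = begin
  ∑ (λ l → A i l * C l j) ≡⟨ ∑-cong (λ l → cong (A i l *_) (C-const l j i j)) ⟩
  ∑ (λ l → A i l * C i j) ≡⟨ ∑-*ʳ (C i j) (A i) ⟩
  ∑ (A i) * C i j         ≡⟨ cong (_* C i j) (A-row i) ⟩
  1ℚ * C i j              ≡⟨ *-identityˡ (C i j) ⟩
  C i j                   ∎
  where open ≡-Reasoning

·-constantˡ : {A : Matrix n n} {C : Matrix m n} → RowStochastic (A ᵀ) → Constant C → C · A ≋ C
·-constantˡ {A = A} {C} Aᵀ-row C-const i j = begin
  ∑ (λ l → C i l * A l j) ≡⟨ ∑-cong (λ l → cong (_* A l j) (C-const i l i j)) ⟩
  ∑ (λ l → C i j * A l j) ≡⟨ ∑-*ˡ (C i j) (λ l → A l j) ⟩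
  C i j * ∑ (λ l → A l j) ≡⟨ cong (C i j *_) (Aᵀ-row j) ⟩
  C i j * 1ℚ              ≡⟨ *-identityʳ (C i j) ⟩
  C i j                   ∎
  where open ≡-Reasoning

refl2-linear : (A : Matrix n n) → refl2 A ≋ two ⊙ A ⊕ (- 1ℚ) ⊙ I
refl2-linear A i j =
  solve 2 (λ a δ → (a :+ a) :- δ := con two :* a :+ con (- 1ℚ) :* δ) refl (A i j) (I i j)

refl2-·-refl2 : (A B : Matrix n n) {C : Matrix n n} → A · B ≋ C →
  refl2 A · refl2 B ≋ (two * two) ⊙ C ⊕ (two * - 1ℚ) ⊙ A ⊕ (- 1ℚ * two) ⊙ B ⊕ (- 1ℚ * - 1ℚ) ⊙ I
refl2-·-refl2 A B AB≋C i j =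
  trans (·-cong (refl2-linear A) (refl2-linear B) i j)
        (·-bilinear two A (- 1ℚ) I two B (- 1ℚ) I
           AB≋C (·-identityʳ A) (·-identityˡ B) (·-identityˡ I) i j)

module _ {A B : Matrix n n} (A-idem : Idempotent A) (B-idem : Idempotent B)
         (AB≋B : A · B ≋ B) (BA≋B : B · A ≋ B) where

  ⊖-square : (B ⊖ A) · (B ⊖ A) ≋ (- 1ℚ) ⊙ (B ⊖ A)
  ⊖-square i j = trans (·-bilinear 1ℚ B (- 1ℚ) A 1ℚ B (- 1ℚ) A B-idem BA≋B AB≋B A-idem i j)
    (solve 2 (λ b a → con 1ℚ :* con 1ℚ :* b :+ con 1ℚ :* con (- 1ℚ) :* b
                        :+ con (- 1ℚ) :* con 1ℚ :* b :+ con (- 1ℚ) :* con (- 1ℚ) :* a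
                      := con (- 1ℚ) :* (con 1ℚ :* b :+ con (- 1ℚ) :* a))
       refl (B i j) (A i j))

  square≋I : {U : Matrix n n} → U ≋ 1ℚ ⊙ I ⊕ two ⊙ (B ⊖ A) → U · U ≋ I
  square≋I {U} U≋ i j = begin
    (U · U) i j
      ≡⟨ ·-cong U≋ U≋ i j ⟩
    ((1ℚ ⊙ I ⊕ two ⊙ (B ⊖ A)) · (1ℚ ⊙ I ⊕ two ⊙ (B ⊖ A))) i j
      ≡⟨ ·-bilinear 1ℚ I two (B ⊖ A) 1ℚ I two (B ⊖ A)
           (·-identityˡ I) (·-identityˡ (B ⊖ A)) (·-identityʳ (B ⊖ A)) ⊖-square i j ⟩
    1ℚ * 1ℚ * I i j + 1ℚ * two * (B ⊖ A) i j
      + two * 1ℚ * (B ⊖ A) i j + two * two * (- 1ℚ * (B ⊖ A) i j)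
      ≡⟨ solve 2 (λ δ e → con 1ℚ :* con 1ℚ :* δ :+ con 1ℚ :* con two :* e :+ con two :* con 1ℚ :* e
                            :+ con two :* con two :* (con (- 1ℚ) :* e) := δ)
           refl (I i j) ((B ⊖ A) i j) ⟩
    I i j ∎
    where open ≡-Reasoning

  refl2-·-refl2-involutive : (refl2 A · refl2 B) · (refl2 A · refl2 B) ≋ I
  refl2-·-refl2-involutive = square≋I λ i j → trans (refl2-·-refl2 A B AB≋B i j)
    (solve 3 (λ b a δ → con two :* con two :* b :+ con two :* con (- 1ℚ) :* a
                          :+ con (- 1ℚ) :* con two :* b :+ con (- 1ℚ) :* con (- 1ℚ) :* δ
                        := con 1ℚ :* δ :+ con two :* (con 1ℚ :* b :+ con (- 1ℚ) :* a))
       refl (B i j) (A i j) (I i j))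

  refl2-·-refl2-involutive′ : (refl2 B · refl2 A) · (refl2 B · refl2 A) ≋ I
  refl2-·-refl2-involutive′ = square≋I λ i j → trans (refl2-·-refl2 B A BA≋B i j)
    (solve 3 (λ b a δ → con two :* con two :* b :+ con two :* con (- 1ℚ) :* b
                          :+ con (- 1ℚ) :* con two :* a :+ con (- 1ℚ) :* con (- 1ℚ) :* δ
                        := con 1ℚ :* δ :+ con two :* (con 1ℚ :* b :+ con (- 1ℚ) :* a))
       refl (B i j) (A i j) (I i j))

module IncidenceProjection {m n} (g : Fin m → Fin n) where

  R : Matrix m m
  R = projection (incidence g)

  fibreSize : Fin n → ℚ
  fibreSize v = ∑ (λ l → incidence g l v)

  incidence-≡ : ∀ {a v} → g a ≡ v → incidence g a v ≡ 1ℚ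
  incidence-≡ {a} {v} ga≡v with g a ≟ᶠ v
  ... | yes _    = refl
  ... | no  ga≢v = ⊥-elim (ga≢v ga≡v)

  incidence-≢ : ∀ {a v} → g a ≢ v → incidence g a v ≡ 0ℚ
  incidence-≢ {a} {v} ga≢v with g a ≟ᶠ v
  ... | yes ga≡v = ⊥-elim (ga≢v ga≡v)
  ... | no  _    = refl

  incidence-idem : ∀ a v → incidence g a v * incidence g a v ≡ incidence g a v
  incidence-idem a v with g a ≟ᶠ v
  ... | yes _ = refl
  ... | no  _ = refl

  incidence-nonneg : ∀ a v → 0ℚ ≤ incidence g a v
  incidence-nonneg a v with g a ≟ᶠ v
  ... | yes _ = nonNegative⁻¹ 1ℚ
  ... | no  _ = ≤-refl

  inv-fibreSize : ∀ a → inv (fibreSize (g a)) * fibreSize (g a) ≡ 1ℚ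
  inv-fibreSize a = inv-inverseˡ (fibreSize (g a)) (≢-sym (<⇒≢ fibreSize-pos))
    where
    fibreSize-pos : 0ℚ < fibreSize (g a)
    fibreSize-pos = ∑-pos _ a (λ l → incidence-nonneg l (g a))
                      (subst (0ℚ <_) (sym (incidence-≡ refl)) (positive⁻¹ 1ℚ))

  projection-incidence : ∀ a b → R a b ≡ inv (fibreSize (g a)) * incidence g b (g a)
  projection-incidence a b = begin
    ∑ (λ v → N a v * C v b)
      ≡⟨ ∑-*-singleˡ (N a) (λ v → C v b) (g a) (λ v v≢ga → incidence-≢ (v≢ga ∘ sym)) ⟩
    N a (g a) * C (g a) b
      ≡⟨ trans (cong (_* C (g a) b) (incidence-≡ refl)) (*-identityˡ (C (g a) b)) ⟩
    ∑ (λ w → diagInv D (g a) w * N b w)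
      ≡⟨ ∑-*-singleˡ (diagInv D (g a)) (N b) (g a) (λ w w≢ga → diagInv-offdiag D (w≢ga ∘ sym)) ⟩
    diagInv D (g a) (g a) * N b (g a)
      ≡⟨ cong (_* N b (g a)) (diagInv-diag D (g a)) ⟩
    inv (D (g a) (g a)) * N b (g a)
      ≡⟨ cong (λ x → inv x * N b (g a)) (∑-cong (λ l → incidence-idem l (g a))) ⟩
    inv (fibreSize (g a)) * N b (g a) ∎
    where
    open ≡-Reasoning
    N = incidence g
    D = N ᵀ · N
    C = diagInv D · N ᵀ

  R-≡ : ∀ {a b} → g a ≡ g b → R a b ≡ inv (fibreSize (g a))
  R-≡ {a} {b} ga≡gb = begin
    R a b
      ≡⟨ projection-incidence a b ⟩
    inv (fibreSize (g a)) * incidence g b (g a)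
      ≡⟨ cong (inv (fibreSize (g a)) *_) (incidence-≡ (sym ga≡gb)) ⟩
    inv (fibreSize (g a)) * 1ℚ
      ≡⟨ *-identityʳ (inv (fibreSize (g a))) ⟩
    inv (fibreSize (g a)) ∎
    where open ≡-Reasoning

  R-≢ : ∀ {a b} → g a ≢ g b → R a b ≡ 0ℚ
  R-≢ {a} {b} ga≢gb = begin
    R a b
      ≡⟨ projection-incidence a b ⟩
    inv (fibreSize (g a)) * incidence g b (g a)
      ≡⟨ cong (inv (fibreSize (g a)) *_) (incidence-≢ (ga≢gb ∘ sym)) ⟩
    inv (fibreSize (g a)) * 0ℚ
      ≡⟨ *-zeroʳ (inv (fibreSize (g a))) ⟩
    0ℚ ∎
    where open ≡-Reasoning

  R-fibre : ∀ {a a′} b → g a ≡ g a′ → R a b ≡ R a′ b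
  R-fibre {a} {a′} b ga≡ga′ = begin
    R a b
      ≡⟨ projection-incidence a b ⟩
    inv (fibreSize (g a)) * incidence g b (g a)
      ≡⟨ cong (λ v → inv (fibreSize v) * incidence g b v) ga≡ga′ ⟩
    inv (fibreSize (g a′)) * incidence g b (g a′)
      ≡⟨ projection-incidence a′ b ⟨
    R a′ b ∎
    where open ≡-Reasoning

  R-symmetric : Symmetric R
  R-symmetric a b with g a ≟ᶠ g b
  ... | yes ga≡gb = trans (R-≡ ga≡gb) (trans (cong (inv ∘ fibreSize) ga≡gb) (sym (R-≡ (sym ga≡gb))))
  ... | no  ga≢gb = trans (R-≢ ga≢gb) (sym (R-≢ (ga≢gb ∘ sym)))

  R-rowStochastic : RowStochastic R
  R-rowStochastic a = trans (∑-cong (projection-incidence a))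
    (trans (∑-*ˡ (inv (fibreSize (g a))) (λ b → incidence g b (g a))) (inv-fibreSize a))

  R-columnStochastic : RowStochastic (R ᵀ)
  R-columnStochastic b = trans (∑-cong (λ a → R-symmetric a b)) (R-rowStochastic b)

  R-idempotent : Idempotent R
  R-idempotent a b = begin
    ∑ (λ l → R a l * R l b)  ≡⟨ ∑-cong R-step ⟩
    ∑ (λ l → R a l * R a b)  ≡⟨ ∑-*ʳ (R a b) (R a) ⟩
    ∑ (R a) * R a b          ≡⟨ cong (_* R a b) (R-rowStochastic a) ⟩
    1ℚ * R a b               ≡⟨ *-identityˡ (R a b) ⟩
    R a b                    ∎
    where
    open ≡-Reasoning
    R-step : ∀ l → R a l * R l b ≡ R a l * R a b
    R-step l with g a ≟ᶠ g l
    ... | yes ga≡gl = cong (R a l *_) (R-fibre b (sym ga≡gl))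
    ... | no  ga≢gl rewrite R-≢ ga≢gl = trans (*-zeroˡ (R l b)) (sym (*-zeroˡ (R a b)))

  R-constant : (∀ a a′ → g a ≡ g a′) → Constant R
  R-constant g-const a b a′ b′ = begin
    R a b    ≡⟨ R-fibre b (g-const a a′) ⟩
    R a′ b   ≡⟨ R-symmetric a′ b ⟩
    R b a′   ≡⟨ R-fibre a′ (g-const b b′) ⟩
    R b′ a′  ≡⟨ R-symmetric b′ a′ ⟩
    R a′ b′  ∎
    where open ≡-Reasoning

corollary5p3 : (X : OrientableMap) → OrientableMap.nV X ≡ 1 ⊎ OrientableMap.nF X ≡ 1 → ∀ i j → (transition X · transition X) i j ≡ I i j
corollary5p3 X (inj₁ nV≡1) =
  refl2-·-refl2-involutive F.R-idempotent V.R-idempotent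
    (·-constantʳ F.R-rowStochastic V-const) (·-constantˡ F.R-columnStochastic V-const)
  where
  open OrientableMap X
  module V = IncidenceProjection tail
  module F = IncidenceProjection face
  V-const : Constant V.R
  V-const = V.R-constant (λ a a′ → Fin1-irrelevant nV≡1 (tail a) (tail a′))
corollary5p3 X (inj₂ nF≡1) =
  refl2-·-refl2-involutive′ V.R-idempotent F.R-idempotent
    (·-constantʳ V.R-rowStochastic F-const) (·-constantˡ V.R-columnStochastic F-const)
  where
  open OrientableMap X
  module V = IncidenceProjection tail
  module F = IncidenceProjection face
  F-const : Constant F.R
  F-const = F.R-constant (λ a a′ → Fin1-irrelevant nF≡1 (face a) (face a′))
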